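{- Let $\mathcal{G}=(H,\sigma,\alpha,h_0)$ be a rooted combinatorial map, $T$ a spanning tree of its underlying graph rooted at the root-vertex $v_0$, and $e'=\{h_1',h_2'\}$ an external edge with $h_1'<h_2'$ in the $(\mathcal{G},T)$-order. Then $e'$ is $(\mathcal{G},T)$-active if and only if the vertex incident to $h_1'$ is an ancestor, in $T$, of the vertex incident to $h_2'$.
   Context: A rooted combinatorial map is $\mathcal{G}=(H,\sigma,\alpha,h_0)$ with $H$ a finite set of half-edges, $\sigma$ a permutation, $\alpha$ a fixed-point-free involution, $\langle\sigma,\alpha\rangle$ transitive on $H$, root $h_0$; underlying graph: vertices the cycles of $\sigma$, edges the pairs $\{h,\alpha(h)\}$, a half-edge being incident to the vertex containing it; the root-vertex $v_0$ is the vertex containing $h_0$, and the tree $T$ is rooted at $v_0$ (a vertex counts as an ancestor of itself). For a spanning tree $T$: edges in $T$ are internal, others external; the motion function $t(h)=\sigma\alpha(h)$ if the edge of $h$ is internal, $\sigma(h)$ otherwise, is a cyclic permutation of $H$; the $(\mathcal{G},T)$-order on $H$ is $h_0<t(h_0)<\dots<t^{|H|-1}(h_0)$, edges compared via their smaller half-edge. The fundamental cycle of an external edge $e$ is the set of $e'$ with $T-e'+e$ a spanning tree; an external edge is $(\mathcal{G},T)$-active if it is minimal in its fundamental cycle for the $(\mathcal{G},T)$-order. -}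

module Defs where

open import Data.Nat using (ℕ; zero; suc; _<_)
open import Data.Fin using (Fin; _≟_)
open import Data.Fin.Permutation using (Permutation′; _⟨$⟩ʳ_)
open import Data.Bool using (Bool; true; false; _∧_; _∨_; not)
open import Data.List using (List; []; _∷_)
open import Data.List.Relation.Unary.Any using (Any)
open import Data.List.Relation.Unary.AllPairs using (AllPairs)
open import Data.Product using (Σ; ∃; _×_; _,_)
open import Data.Sum using (_⊎_)
open import Relation.Nullary using (¬_)
open import Relation.Nullary.Decidable using (⌊_⌋)
open import Relation.Binary.PropositionalEquality using (_≡_; _≢_)

iter : ∀ {A : Set} → (A → A) → ℕ → A → A
iter f zero x = x
iter f (suc k) x = f (iter f k x)

-- reachability under the generators σ, α (in a finite set this is the
-- orbit relation of the group ⟨σ, α⟩, since σ⁻¹ is a power of σ and α⁻¹ = α)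
data Reach {n : ℕ} (s a : Fin n → Fin n) : Fin n → Fin n → Set where
  here  : ∀ {h} → Reach s a h h
  viaσ  : ∀ {h h'} → Reach s a (s h) h' → Reach s a h h'
  viaα  : ∀ {h h'} → Reach s a (a h) h' → Reach s a h h'

record RootedMap (n : ℕ) : Set where
  field
    σ          : Permutation′ n
    α          : Fin n → Fin n
    α-invol    : ∀ h → α (α h) ≡ h
    α-fpf      : ∀ h → α h ≢ h
    transitive : ∀ h h' → Reach (σ ⟨$⟩ʳ_) α h h'
    h₀         : Fin n

module _ {n : ℕ} (M : RootedMap n) where
  open RootedMap M

  σf : Fin n → Fin n
  σf h = σ ⟨$⟩ʳ h

  SameV : Fin n → Fin n → Set
  SameV h h' = ∃ λ k → iter σf k h ≡ h'

  -- a set of edges is a predicate on half-edges closed under α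
  -- (h belongs to the edge {g, α g})
  inEdge : Fin n → Fin n → Bool
  inEdge g x = ⌊ x ≟ g ⌋ ∨ ⌊ x ≟ α g ⌋

  -- connectivity of the spanning subgraph with edge set S:
  -- moving around a vertex (σ) or along an edge of S (α)
  data Conn (S : Fin n → Bool) : Fin n → Fin n → Set where
    here : ∀ {h} → Conn S h h
    viaσ : ∀ {h h'} → Conn S (σf h) h' → Conn S h h'
    viaα : ∀ {h h'} → S h ≡ true → Conn S (α h) h' → Conn S h h'

  EdgeSet : (Fin n → Bool) → Set
  EdgeSet S = ∀ h → S h ≡ S (α h)

  Connected : (Fin n → Bool) → Set
  Connected S = ∀ h h' → Conn S h h'

  removeEdge : (Fin n → Bool) → Fin n → (Fin n → Bool)
  removeEdge S g x = S x ∧ not (inEdge g x)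

  addEdge : (Fin n → Bool) → Fin n → (Fin n → Bool)
  addEdge S g x = S x ∨ inEdge g x

  SpanningTree : (Fin n → Bool) → Set
  SpanningTree S = EdgeSet S × Connected S
                   × (∀ g → S g ≡ true → ¬ Connected (removeEdge S g))

  motion : (Fin n → Bool) → Fin n → Fin n
  motion T h with T h
  ... | true  = σf (α h)
  ... | false = σf h

  OrdLt : (Fin n → Bool) → Fin n → Fin n → Set
  OrdLt T h h' = Σ ℕ λ i → Σ ℕ λ j → i < j × j < n
                 × iter (motion T) i h₀ ≡ h × iter (motion T) j h₀ ≡ h'

  -- edge {g, α g} < edge {h, α h}: smaller half-edge of the first is below
  -- the smaller half-edge of the second
  EdgeLt : (Fin n → Bool) → Fin n → Fin n → Set
  EdgeLt T g h = Σ (Fin n) λ a → (a ≡ g ⊎ a ≡ α g)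
                 × OrdLt T a h × OrdLt T a (α h)

  -- edge of g lies in the fundamental cycle of the external edge of e
  InFundCycle : (Fin n → Bool) → Fin n → Fin n → Set
  InFundCycle T e g = SpanningTree (addEdge (removeEdge T g) e)

  Active : (Fin n → Bool) → Fin n → Set
  Active T e = T e ≡ false × (∀ g → InFundCycle T e g → ¬ EdgeLt T g e)

  -- paths in T: TPath a b vs — a path from the vertex of a to the vertex of b,
  -- vs listing representatives of the visited vertices
  data TPath (T : Fin n → Bool) : Fin n → Fin n → List (Fin n) → Set where
    stop : ∀ {a b} → SameV a b → TPath T a b (a ∷ [])
    step : ∀ {a h c vs} → SameV a h → T h ≡ true → TPath T (α h) c vs
           → TPath T a c (a ∷ vs)

  -- vertex of u is an ancestor of vertex of v in T rooted at the vertex of h₀: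
  -- u lies on the (simple) T-path from the root vertex to v
  Ancestor : (Fin n → Bool) → Fin n → Fin n → Set
  Ancestor T u v = Σ (List (Fin n)) λ vs → TPath T h₀ v vs
                   × AllPairs (λ x y → ¬ SameV x y) vs × Any (SameV u) vs

-- For a tree half-edge d, call "beyond d" the side of T − d that contains α d.
-- Started at d, the motion function runs through exactly the half-edges beyond d
-- before reaching α d (by induction on the size of that side); hence it is cyclic,
-- and if the root is not beyond d, the half-edges beyond d form the interval of the
-- (G,T)-order that starts right after d and ends at α d. An external edge e lies in
-- the fundamental cycle of a tree edge d iff d separates e from α e.
-- Both sides of the theorem are then equivalent to the cut form of ancestry: every
-- tree edge separating h₁ from the root also separates h₂ from it. An edge violating
-- this has h₁ beyond it but not h₂, so it lies in the fundamental cycle of h₁ and is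
-- visited before h₁; conversely, for an edge of that cycle oriented away from the
-- root, h₂ is beyond it and h₁ is not, so the interval puts both its half-edges
-- after h₁. On the path side, a simple tree path from the root never returns across
-- an edge it has crossed, and a vertex off the path from the root to v is cut off
-- from both by a single tree edge.

module Submission where

open import Defs
open import Data.Bool using (Bool; true; false; not; _∧_; _∨_)
import Data.Bool as Bool
open import Data.Bool.Properties
  using (not-involutive; not-injective; ¬-not; ∨-zeroʳ; ∨-identityʳ; ∧-zeroʳ; ∧-identityʳ)
open import Data.Empty using (⊥; ⊥-elim)
open import Data.Fin using (Fin; toℕ; fromℕ<; _≟_)
open import Data.Fin.Permutation using (_⟨$⟩ˡ_; inverseˡ)
open import Data.Fin.Properties using (pigeonhole; injective⇒≤; toℕ-fromℕ<; toℕ<n; any?)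
open import Data.Fin.Subset using (Subset; _∈_; ∣_∣)
open import Data.Fin.Subset.Properties using (p⊂q⇒∣p∣<∣q∣)
open import Data.List using (List)
open import Data.List.Relation.Unary.All as All using ([]; _∷_)
open import Data.List.Relation.Unary.All.Properties using (¬Any⇒All¬; All¬⇒¬Any)
open import Data.List.Relation.Unary.AllPairs using (AllPairs; []; _∷_)
open import Data.List.Relation.Unary.Any as Any using (Any; here; there)
open import Data.Nat using (ℕ; zero; suc; _+_; _*_; _≤_; _<_; s≤s)
open import Data.Nat.DivMod using (_%_; _/_; m≡m%n+[m/n]*n; m%n<n)
open import Data.Nat.Induction using (<-wellFounded)
open import Data.Nat.Properties
  using (+-suc; +-comm; *-suc; n<1+n; m≤n⇒∃[o]m+o≡n; m≤n⇒m<n∨m≡n; m≤n+m; +-monoˡ-≤; +-cancelˡ-<; ≤-pred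
        ; ≤-refl; ≤-trans; <-trans; <-≤-trans; ≤-antisym; <-irrefl; <-cmp; _<?_; _≤?_; <⇒≤; <⇒≱; ≮⇒≥; ≰⇒>)
open import Data.Product using (∃; _×_; _,_; proj₁; proj₂)
open import Data.Sum using (_⊎_; inj₁; inj₂)
open import Data.Vec using (tabulate)
open import Data.Vec.Properties using (lookup∘tabulate; []=⇒lookup; lookup⇒[]=)
open import Function using (_∘_)
open import Function.Definitions using (Injective)
open import Induction.WellFounded using (Acc; acc)
open import Relation.Binary using (tri<; tri≈; tri>)
open import Relation.Binary.Construct.Closure.Transitive using (TransClosure; [_]; _∷_; _++_; _∷ʳ_)
open import Relation.Binary.PropositionalEquality
open import Relation.Nullary using (¬_; Dec; does; yes; no)
open import Relation.Nullary.Decidable using (map′; _⊎-dec_; dec-true; dec-false; isYes≗does)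

true-or-false : ∀ b → b ≡ true ⊎ b ≡ false
true-or-false true  = inj₁ refl
true-or-false false = inj₂ refl

≢-≢⇒≡ : ∀ {x y z : Bool} → x ≢ y → y ≢ z → x ≡ z
≢-≢⇒≡ x≢y y≢z = trans (¬-not x≢y) (sym (¬-not (≢-sym y≢z)))

true-false-clash : ∀ {b} → b ≡ true → b ≡ false → ⊥
true-false-clash refl ()

module _ {A : Set} (f : A → A) where

  iter-+ : ∀ a b x → iter f (a + b) x ≡ iter f a (iter f b x)
  iter-+ zero    b x = refl
  iter-+ (suc a) b x = cong f (iter-+ a b x)

  iter-*-period : ∀ {r x} → iter f (suc r) x ≡ x → ∀ m → iter f (m * suc r) x ≡ x
  iter-*-period ret zero    = refl
  iter-*-period {r} {x} ret (suc m) = begin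
    iter f (suc r + m * suc r) x          ≡⟨ iter-+ (suc r) (m * suc r) x ⟩
    iter f (suc r) (iter f (m * suc r) x) ≡⟨ cong (iter f (suc r)) (iter-*-period ret m) ⟩
    iter f (suc r) x                      ≡⟨ ret ⟩
    x                                     ∎
    where open ≡-Reasoning

  iter-% : ∀ {r x} → iter f (suc r) x ≡ x → ∀ k → iter f k x ≡ iter f (k % suc r) x
  iter-% {r} {x} ret k = begin
    iter f k x                                             ≡⟨ cong (λ j → iter f j x) (m≡m%n+[m/n]*n k (suc r)) ⟩
    iter f (k % suc r + (k / suc r) * suc r) x             ≡⟨ iter-+ (k % suc r) _ x ⟩
    iter f (k % suc r) (iter f ((k / suc r) * suc r) x)    ≡⟨ cong (iter f (k % suc r)) (iter-*-period ret (k / suc r)) ⟩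
    iter f (k % suc r) x                                   ∎
    where open ≡-Reasoning

  Step : (A → Set) → A → A → Set
  Step P a b = f a ≡ b × P b

  Walk : (A → Set) → A → A → Set
  Walk P = TransClosure (Step P)

  Walk-mono : ∀ {P Q : A → Set} → (∀ {x} → P x → Q x) → ∀ {a b} → Walk P a b → Walk Q a b
  Walk-mono P⊆Q [ eq , Pb ]     = [ eq , P⊆Q Pb ]
  Walk-mono P⊆Q ((eq , Py) ∷ w) = (eq , P⊆Q Py) ∷ Walk-mono P⊆Q w

  walk-interval : ∀ {P x₀ p b} → Walk P (iter f p x₀) b
                → ∃ λ q → p < q × iter f q x₀ ≡ b × (∀ {k} → p < k → k ≤ q → P (iter f k x₀))
  walk-interval {P} {x₀} {p} [ refl , Pb ] =
    suc p , ≤-refl , refl , λ p<k k≤1+p → subst (λ k → P (iter f k x₀)) (sym (≤-antisym k≤1+p p<k)) Pb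
  walk-interval {P} {x₀} {p} ((refl , Py) ∷ w) with q , 1+p<q , eq , inside ← walk-interval {p = suc p} w =
    q , <-trans (n<1+n p) 1+p<q , eq , inside′
    where
      inside′ : ∀ {k} → p < k → k ≤ q → P (iter f k x₀)
      inside′ p<k k≤q with m≤n⇒m<n∨m≡n p<k
      ... | inj₁ 1+p<k = inside 1+p<k k≤q
      ... | inj₂ refl  = Py

-- Orbits of an injective function on a finite set

module _ {n : ℕ} {f : Fin n → Fin n} (f-injective : Injective _≡_ _≡_ f) where

  iter-injective : ∀ k {a b} → iter f k a ≡ iter f k b → a ≡ b
  iter-injective zero    eq = eq
  iter-injective (suc k) eq = iter-injective k (f-injective eq)

  iter-cancel : ∀ i o x → iter f (suc (i + o)) x ≡ iter f i x → iter f (suc o) x ≡ x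
  iter-cancel i o x eq = iter-injective i (begin
    iter f i (iter f (suc o) x) ≡⟨ iter-+ f i (suc o) x ⟨
    iter f (i + suc o) x        ≡⟨ cong (λ j → iter f j x) (+-suc i o) ⟩
    iter f (suc (i + o)) x      ≡⟨ eq ⟩
    iter f i x                  ∎)
    where open ≡-Reasoning

  iter-returns : ∀ x → ∃ λ r → suc r ≤ n × iter f (suc r) x ≡ x
  iter-returns x with i , j , i<j , eq ← pigeonhole (n<1+n n) (λ k → iter f (toℕ k) x)
                 with o , 1+i+o≡j ← m≤n⇒∃[o]m+o≡n i<j =
    o , bound , iter-cancel (toℕ i) o x (trans (cong (λ k → iter f k x) 1+i+o≡j) (sym eq))
    where
      bound : suc o ≤ n
      bound = ≤-trans (s≤s (m≤n+m o (toℕ i))) (subst (_≤ n) (sym 1+i+o≡j) (≤-pred (toℕ<n j)))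

  iter-reduce : ∀ k x {y} → iter f k x ≡ y → ∃ λ j → j < n × iter f j x ≡ y
  iter-reduce k x eq with r , r<n , ret ← iter-returns x =
    k % suc r , ≤-trans (m%n<n k (suc r)) r<n , trans (sym (iter-% f ret k)) eq

  iter-inverse : ∀ k {x y} → iter f k x ≡ y → ∃ λ j → iter f j y ≡ x
  iter-inverse k {x} refl with r , _ , ret ← iter-returns x = k * r , (begin
    iter f (k * r) (iter f k x) ≡⟨ iter-+ f (k * r) k x ⟨
    iter f (k * r + k) x        ≡⟨ cong (λ j → iter f j x) (trans (+-comm (k * r) k) (sym (*-suc k r))) ⟩
    iter f (k * suc r) x        ≡⟨ iter-*-period f ret k ⟩
    x                           ∎)
    where open ≡-Reasoning

  module _ (x₀ : Fin n) (covers : ∀ y → ∃ λ k → iter f k x₀ ≡ y) where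

    period-≥ : ∀ {r} → iter f (suc r) x₀ ≡ x₀ → n ≤ suc r
    period-≥ {r} ret = injective⇒≤ position-injective
      where
        position : Fin n → Fin (suc r)
        position y = fromℕ< (m%n<n (proj₁ (covers y)) (suc r))

        at-position : ∀ y → iter f (toℕ (position y)) x₀ ≡ y
        at-position y with k , eq ← covers y =
          trans (cong (λ j → iter f j x₀) (toℕ-fromℕ< (m%n<n k (suc r)))) (trans (sym (iter-% f ret k)) eq)

        position-injective : Injective _≡_ _≡_ position
        position-injective {a} {b} eq =
          trans (sym (at-position a)) (trans (cong (λ i → iter f (toℕ i) x₀) eq) (at-position b))

    iter-period : iter f n x₀ ≡ x₀
    iter-period with r , r<n , ret ← iter-returns x₀ =
      subst (λ k → iter f k x₀ ≡ x₀) (≤-antisym r<n (period-≥ ret)) ret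

    iter-+-period : ∀ k → iter f (k + n) x₀ ≡ iter f k x₀
    iter-+-period k = trans (iter-+ f k n x₀) (cong (iter f k) iter-period)

    iter-distinct : ∀ {a b} → a < b → b < a + n → iter f a x₀ ≢ iter f b x₀
    iter-distinct {a} a<b b<a+n eq with o , refl ← m≤n⇒∃[o]m+o≡n a<b =
      <⇒≱ (+-cancelˡ-< a (suc o) n (subst (_< a + n) (sym (+-suc a o)) b<a+n))
          (period-≥ (iter-cancel a o x₀ (sym eq)))

    -- The two runs fill exactly one period: a = p + n.
    true-run-bounds : (c : Fin n → Bool) {p q a : ℕ} → p < n → p < q → q < a → iter f a x₀ ≡ iter f p x₀
             → (∀ {k} → p < k → k ≤ q → c (iter f k x₀) ≡ true)
             → (∀ {k} → q < k → k ≤ a → c (iter f k x₀) ≡ false)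
             → c x₀ ≡ false
             → q < n × (∀ {k} → k < n → c (iter f k x₀) ≡ true → p < k × k ≤ q)
    true-run-bounds c {p} {q} {a} p<n p<q q<a xa≡xp run₁ run₂ cx₀ = q<n , bounds
      where
        q<n : q < n
        q<n with q <? n
        ... | yes q<n = q<n
        ... | no  q≮n = ⊥-elim (true-false-clash (run₁ p<n (≮⇒≥ q≮n)) (trans (cong c iter-period) cx₀))

        a≡p+n : a ≡ p + n
        a≡p+n with <-cmp a (p + n)
        ... | tri< a<p+n _ _ = ⊥-elim (iter-distinct (<-trans p<q q<a) a<p+n (sym xa≡xp))
        ... | tri≈ _ a≡p+n _ = a≡p+n
        ... | tri> _ _ p+n<a = ⊥-elim (true-false-clash (run₁ (n<1+n p) p<q)
                                (trans (cong (c ∘ f) (sym (iter-+-period p)))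
                                       (run₂ (<-trans (≤-trans q<n (m≤n+m n p)) (n<1+n (p + n))) p+n<a)))

        bounds : ∀ {k} → k < n → c (iter f k x₀) ≡ true → p < k × k ≤ q
        bounds {k} k<n ck = after-start , before-end
          where
            after-start : p < k
            after-start with p <? k
            ... | yes p<k = p<k
            ... | no  p≮k = ⊥-elim (true-false-clash ck (trans (cong c (sym (iter-+-period k)))
                              (run₂ (≤-trans q<n (m≤n+m n k))
                                    (subst (k + n ≤_) (sym a≡p+n) (+-monoˡ-≤ n (≮⇒≥ p≮k))))))

            before-end : k ≤ q
            before-end with k ≤? q
            ... | yes k≤q = k≤q
            ... | no  k≰q = ⊥-elim (true-false-clash ck
                              (run₂ (≰⇒> k≰q) (subst (k ≤_) (sym a≡p+n) (≤-trans (<⇒≤ k<n) (m≤n+m n p)))))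

    index : ∀ y → ∃ λ k → k < n × iter f k x₀ ≡ y
    index y with k , eq ← covers y = iter-reduce k x₀ eq

    index-unique : ∀ {a b} → a < n → b < n → iter f a x₀ ≡ iter f b x₀ → a ≡ b
    index-unique {a} {b} a<n b<n eq with <-cmp a b
    ... | tri< a<b _ _ = ⊥-elim (iter-distinct a<b (≤-trans b<n (m≤n+m n a)) eq)
    ... | tri≈ _ a≡b _ = a≡b
    ... | tri> _ _ b<a = ⊥-elim (iter-distinct b<a (≤-trans a<n (m≤n+m n b)) (sym eq))

module MapFacts {n : ℕ} (M : RootedMap n) where
  open RootedMap M

  σ-injective : Injective _≡_ _≡_ (σf M)
  σ-injective eq = trans (sym (inverseˡ σ)) (trans (cong (σ ⟨$⟩ˡ_) eq) (inverseˡ σ))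

  α-injective : Injective _≡_ _≡_ α
  α-injective {a} {b} eq = trans (sym (α-invol a)) (trans (cong α eq) (α-invol b))

  SameV-refl : ∀ {a} → SameV M a a
  SameV-refl = 0 , refl

  SameV-σ : ∀ {a} → SameV M a (σf M a)
  SameV-σ = 1 , refl

  SameV-trans : ∀ {a b c} → SameV M a b → SameV M b c → SameV M a c
  SameV-trans {a} (k , refl) (l , refl) = l + k , iter-+ (σf M) l k a

  SameV-sym : ∀ {a b} → SameV M a b → SameV M b a
  SameV-sym (k , eq) = iter-inverse σ-injective k eq

  SameV? : ∀ a b → Dec (SameV M a b)
  SameV? a b = map′ from-Fin below-n (any? (λ i → iter (σf M) (toℕ i) a ≟ b))
    where
      from-Fin : (∃ λ (i : Fin n) → iter (σf M) (toℕ i) a ≡ b) → SameV M a b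
      from-Fin (i , eq) = toℕ i , eq

      below-n : SameV M a b → ∃ λ (i : Fin n) → iter (σf M) (toℕ i) a ≡ b
      below-n (k , eq) with j , j<n , eq′ ← iter-reduce σ-injective k a eq =
        fromℕ< j<n , trans (cong (λ i → iter (σf M) i a) (toℕ-fromℕ< j<n)) eq′

  module _ {S : Fin n → Bool} where

    Conn-trans : ∀ {a b c} → Conn M S a b → Conn M S b c → Conn M S a c
    Conn-trans here       q = q
    Conn-trans (viaσ p)   q = viaσ (Conn-trans p q)
    Conn-trans (viaα s p) q = viaα s (Conn-trans p q)

    SameV⇒Conn : ∀ {a b} → SameV M a b → Conn M S a b
    SameV⇒Conn (zero  , refl) = here
    SameV⇒Conn (suc k , refl) = Conn-trans (SameV⇒Conn (k , refl)) (viaσ here)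

    Conn-invariant : (P : Fin n → Set) → (∀ x → P x → P (σf M x)) → (∀ x → S x ≡ true → P x → P (α x))
                   → ∀ {a b} → Conn M S a b → P a → P b
    Conn-invariant P P-σ P-α here       Pa = Pa
    Conn-invariant P P-σ P-α (viaσ p)   Pa = Conn-invariant P P-σ P-α p (P-σ _ Pa)
    Conn-invariant P P-σ P-α (viaα s p) Pa = Conn-invariant P P-σ P-α p (P-α _ s Pa)

    Conn-preserves : (f : Fin n → Bool) → (∀ x → f (σf M x) ≡ f x) → (∀ x → S x ≡ true → f (α x) ≡ f x)
                   → ∀ {a b} → Conn M S a b → f a ≡ f b
    Conn-preserves f f-σ f-α {a} p =
      Conn-invariant (λ z → f a ≡ f z) (λ x eq → trans eq (sym (f-σ x))) (λ x s eq → trans eq (sym (f-α x s))) p refl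

    Conn-α : ∀ {a} → EdgeSet M S → S a ≡ true → Conn M S (α a) a
    Conn-α {a} S-α s = viaα (trans (sym (S-α a)) s) (subst (Conn M S (α (α a))) (α-invol a) here)

    Conn-sym : EdgeSet M S → ∀ {a b} → Conn M S a b → Conn M S b a
    Conn-sym S-α here       = here
    Conn-sym S-α (viaσ p)   = Conn-trans (Conn-sym S-α p) (SameV⇒Conn (SameV-sym SameV-σ))
    Conn-sym S-α (viaα s p) = Conn-trans (Conn-sym S-α p) (Conn-α S-α s)

  Conn-mono : ∀ {S S′} → (∀ x → S x ≡ true → S′ x ≡ true) → ∀ {a b} → Conn M S a b → Conn M S′ a b
  Conn-mono S⊆S′ here       = here
  Conn-mono S⊆S′ (viaσ p)   = viaσ (Conn-mono S⊆S′ p)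
  Conn-mono S⊆S′ (viaα s p) = viaα (S⊆S′ _ s) (Conn-mono S⊆S′ p)

  infix 4 _∈ₑ_ _∈ₑ?_

  _∈ₑ_ : Fin n → Fin n → Set
  x ∈ₑ g = x ≡ g ⊎ x ≡ α g

  _∈ₑ?_ : ∀ x g → Dec (x ∈ₑ g)
  x ∈ₑ? g = (x ≟ g) ⊎-dec (x ≟ α g)

  ∈ₑ-α : ∀ {x g} → x ∈ₑ g → α x ∈ₑ g
  ∈ₑ-α (inj₁ refl) = inj₂ refl
  ∈ₑ-α (inj₂ refl) = inj₁ (α-invol _)

  α-∈ₑ : ∀ {x g} → α x ∈ₑ g → x ∈ₑ g
  α-∈ₑ {x} αx∈g = subst (_∈ₑ _) (α-invol x) (∈ₑ-α αx∈g)

  ∈ₑ-flip : ∀ {x g} → x ∈ₑ α g → x ∈ₑ g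
  ∈ₑ-flip (inj₁ refl) = inj₂ refl
  ∈ₑ-flip (inj₂ refl) = inj₁ (α-invol _)

  ∈ₑ-sym : ∀ {x g} → x ∈ₑ g → g ∈ₑ x
  ∈ₑ-sym (inj₁ refl) = inj₁ refl
  ∈ₑ-sym (inj₂ refl) = inj₂ (sym (α-invol _))

  ∈ₑ-trans : ∀ {x y z} → x ∈ₑ y → y ∈ₑ z → x ∈ₑ z
  ∈ₑ-trans (inj₁ refl) y∈z         = y∈z
  ∈ₑ-trans (inj₂ refl) (inj₁ refl) = inj₂ refl
  ∈ₑ-trans (inj₂ refl) (inj₂ refl) = inj₁ (α-invol _)

  ∈ₑ-unflip : ∀ {x g} → x ∈ₑ g → x ∈ₑ α g
  ∈ₑ-unflip (inj₁ refl) = inj₂ (sym (α-invol _))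
  ∈ₑ-unflip (inj₂ refl) = inj₁ refl

  inEdge-does : ∀ g x → inEdge M g x ≡ does (x ∈ₑ? g)
  inEdge-does g x = cong₂ _∨_ (isYes≗does (x ≟ g)) (isYes≗does (x ≟ α g))

  inEdge-true : ∀ {g x} → x ∈ₑ g → inEdge M g x ≡ true
  inEdge-true {g} {x} x∈g = trans (inEdge-does g x) (dec-true (x ∈ₑ? g) x∈g)

  inEdge-false : ∀ {g x} → ¬ x ∈ₑ g → inEdge M g x ≡ false
  inEdge-false {g} {x} x∉g = trans (inEdge-does g x) (dec-false (x ∈ₑ? g) x∉g)

  inEdge-α : ∀ g x → inEdge M g (α x) ≡ inEdge M g x
  inEdge-α g x with x ∈ₑ? g
  ... | yes x∈g = trans (inEdge-true (∈ₑ-α x∈g)) (sym (inEdge-true x∈g))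
  ... | no  x∉g = trans (inEdge-false (x∉g ∘ α-∈ₑ)) (sym (inEdge-false x∉g))

  removeEdge-intro : ∀ {S g x} → S x ≡ true → ¬ x ∈ₑ g → removeEdge M S g x ≡ true
  removeEdge-intro sx x∉g = cong₂ (λ b c → b ∧ not c) sx (inEdge-false x∉g)

  removeEdge-elim : ∀ {S g x} → removeEdge M S g x ≡ true → S x ≡ true × ¬ x ∈ₑ g
  removeEdge-elim {S} {g} {x} r with x ∈ₑ? g
  ... | yes x∈g = ⊥-elim (true-false-clash r (trans (cong (λ c → S x ∧ not c) (inEdge-true x∈g)) (∧-zeroʳ (S x))))
  ... | no  x∉g = trans (sym (∧-identityʳ (S x))) (trans (cong (λ c → S x ∧ not c) (sym (inEdge-false x∉g))) r) , x∉g

  addEdge-intro : ∀ {S e x} → S x ≡ true → addEdge M S e x ≡ true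
  addEdge-intro sx = cong (_∨ _) sx

  addEdge-new : ∀ {S e x} → x ∈ₑ e → addEdge M S e x ≡ true
  addEdge-new {S} x∈e = trans (cong (S _ ∨_) (inEdge-true x∈e)) (∨-zeroʳ (S _))

  addEdge-elim : ∀ {S e x} → addEdge M S e x ≡ true → S x ≡ true ⊎ x ∈ₑ e
  addEdge-elim {S} {e} {x} a with x ∈ₑ? e
  ... | yes x∈e = inj₂ x∈e
  ... | no  x∉e = inj₁ (trans (sym (∨-identityʳ (S x))) (trans (cong (S x ∨_) (sym (inEdge-false x∉e))) a))

  removeEdge-EdgeSet : ∀ {S} g → EdgeSet M S → EdgeSet M (removeEdge M S g)
  removeEdge-EdgeSet g S-α x = cong₂ (λ b c → b ∧ not c) (S-α x) (sym (inEdge-α g x))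

  addEdge-EdgeSet : ∀ {S} e → EdgeSet M S → EdgeSet M (addEdge M S e)
  addEdge-EdgeSet e S-α x = cong₂ _∨_ (S-α x) (sym (inEdge-α e x))

  removeEdge-flip : ∀ S g x → removeEdge M S (α g) x ≡ removeEdge M S g x
  removeEdge-flip S g x with x ∈ₑ? g
  ... | yes x∈g = cong (λ c → S x ∧ not c) (trans (inEdge-true (∈ₑ-unflip x∈g)) (sym (inEdge-true x∈g)))
  ... | no  x∉g = cong (λ c → S x ∧ not c) (trans (inEdge-false (x∉g ∘ ∈ₑ-flip)) (sym (inEdge-false x∉g)))

module SpanningTreeFacts {n : ℕ} (M : RootedMap n) {T : Fin n → Bool} (tree : SpanningTree M T) where
  open RootedMap M
  open MapFacts M

  T-EdgeSet : EdgeSet M T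
  T-EdgeSet = proj₁ tree

  T-connected : Connected M T
  T-connected = proj₁ (proj₂ tree)

  T-α : ∀ {x} → T x ≡ true → T (α x) ≡ true
  T-α {x} tx = trans (sym (T-EdgeSet x)) tx

  T∖_ : Fin n → Fin n → Bool
  T∖ d = removeEdge M T d

  T-minimal : ∀ g → T g ≡ true → ¬ Connected M (T∖ g)
  T-minimal = proj₂ (proj₂ tree)

  T∖-EdgeSet : ∀ d → EdgeSet M (T∖ d)
  T∖-EdgeSet d = removeEdge-EdgeSet d T-EdgeSet

  T∖-intro : ∀ {d x} → T x ≡ true → ¬ x ∈ₑ d → (T∖ d) x ≡ true
  T∖-intro = removeEdge-intro {S = T}

  T∖-elim : ∀ {d x} → (T∖ d) x ≡ true → T x ≡ true × ¬ x ∈ₑ d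
  T∖-elim = removeEdge-elim {S = T}

  T∖-flip : ∀ d x → (T∖ d) x ≡ true → (T∖ α d) x ≡ true
  T∖-flip d x = trans (removeEdge-flip T d x)

  -- The two sides of a tree edge

  ends-disconnected : ∀ {d} → T d ≡ true → ¬ Conn M (T∖ d) d (α d)
  ends-disconnected {d} td d~αd = T-minimal d td λ a b → reroute (T-connected a b)
    where
      across : ∀ {x} → x ∈ₑ d → Conn M (T∖ d) x (α x)
      across (inj₁ refl) = d~αd
      across (inj₂ refl) = subst (Conn M (T∖ d) (α d)) (sym (α-invol d)) (Conn-sym (T∖-EdgeSet d) d~αd)

      reroute : ∀ {a b} → Conn M T a b → Conn M (T∖ d) a b
      reroute here                = here
      reroute (viaσ p)            = viaσ (reroute p)
      reroute {a} (viaα ta p) with a ∈ₑ? d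
      ... | yes a∈d = Conn-trans (across a∈d) (reroute p)
      ... | no  a∉d = viaα (T∖-intro ta a∉d) (reroute p)

  end-reachable : ∀ d x → Conn M (T∖ d) (α d) x ⊎ Conn M (T∖ d) d x
  end-reachable d x = Conn-invariant Reaches (λ _ → extend (viaσ here)) Reaches-α (T-connected d x) (inj₂ here)
    where
      Reaches : Fin n → Set
      Reaches z = Conn M (T∖ d) (α d) z ⊎ Conn M (T∖ d) d z

      extend : ∀ {z w} → Conn M (T∖ d) z w → Reaches z → Reaches w
      extend q = Data.Sum.map (λ p → Conn-trans p q) (λ p → Conn-trans p q)

      Reaches-α : ∀ z → T z ≡ true → Reaches z → Reaches (α z)
      Reaches-α z tz r with z ∈ₑ? d
      ... | yes (inj₁ refl) = inj₁ here
      ... | yes (inj₂ refl) = inj₂ (subst (Conn M (T∖ d) d) (sym (α-invol d)) here)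
      ... | no  z∉d         = extend (viaα (T∖-intro tz z∉d) here) r

  -- Meaningful for a tree half-edge d: x lies in the component of α d, not of d, in T − d.
  beyond : Fin n → Fin n → Bool
  beyond d x with end-reachable d x
  ... | inj₁ _ = true
  ... | inj₂ _ = false

  beyond-true : ∀ {d x} → beyond d x ≡ true → Conn M (T∖ d) (α d) x
  beyond-true {d} {x} b with end-reachable d x
  ... | inj₁ p = p

  beyond-false : ∀ {d x} → beyond d x ≡ false → Conn M (T∖ d) d x
  beyond-false {d} {x} b with end-reachable d x
  ... | inj₂ p = p

  module _ {d : Fin n} (td : T d ≡ true) where

    Conn⇒beyond-true : ∀ {x} → Conn M (T∖ d) (α d) x → beyond d x ≡ true
    Conn⇒beyond-true {x} p with end-reachable d x
    ... | inj₁ _ = refl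
    ... | inj₂ q = ⊥-elim (ends-disconnected td (Conn-trans q (Conn-sym (T∖-EdgeSet d) p)))

    Conn⇒beyond-false : ∀ {x} → Conn M (T∖ d) d x → beyond d x ≡ false
    Conn⇒beyond-false {x} q with end-reachable d x
    ... | inj₁ p = ⊥-elim (ends-disconnected td (Conn-trans q (Conn-sym (T∖-EdgeSet d) p)))
    ... | inj₂ _ = refl

    beyond-Conn : ∀ {x y} → Conn M (T∖ d) x y → beyond d x ≡ beyond d y
    beyond-Conn {x} {y} p with end-reachable d x
    ... | inj₁ q = sym (Conn⇒beyond-true (Conn-trans q p))
    ... | inj₂ q = sym (Conn⇒beyond-false (Conn-trans q p))

    beyond-self : beyond d d ≡ false
    beyond-self = Conn⇒beyond-false here

    beyond-α-self : beyond d (α d) ≡ true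
    beyond-α-self = Conn⇒beyond-true here

    beyond-SameV : ∀ {x y} → SameV M x y → beyond d x ≡ beyond d y
    beyond-SameV = beyond-Conn ∘ SameV⇒Conn

    beyond-own-vertex : ∀ {x} → SameV M d x → beyond d x ≡ false
    beyond-own-vertex d~x = trans (sym (beyond-SameV d~x)) beyond-self

    beyond-σ : ∀ x → beyond d (σf M x) ≡ beyond d x
    beyond-σ x = sym (beyond-SameV SameV-σ)

    beyond-α : ∀ {x} → T x ≡ true → ¬ x ∈ₑ d → beyond d (α x) ≡ beyond d x
    beyond-α tx x∉d = sym (beyond-Conn (viaα (T∖-intro tx x∉d) here))

    not-loop : ¬ SameV M d (α d)
    not-loop d~αd = true-false-clash beyond-α-self (beyond-own-vertex d~αd)

  beyond-flip : ∀ {d} → T d ≡ true → ∀ x → beyond (α d) x ≡ not (beyond d x)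
  beyond-flip {d} td x with end-reachable d x
  ... | inj₁ p = Conn⇒beyond-false (T-α td) (Conn-mono (T∖-flip d) p)
  ... | inj₂ q = Conn⇒beyond-true (T-α td)
                   (subst (λ w → Conn M (T∖ α d) w x) (sym (α-invol d)) (Conn-mono (T∖-flip d) q))

  beyond-flip-true : ∀ {d x} → T d ≡ true → beyond (α d) x ≡ true → beyond d x ≡ false
  beyond-flip-true {d} {x} td αd-far =
    trans (sym (not-involutive (beyond d x))) (cong not (trans (sym (beyond-flip td x)) αd-far))

  beyond-nested : ∀ {d y} → T d ≡ true → T y ≡ true → SameV M (α d) y → y ≢ α d
                → ∀ {x} → beyond y x ≡ true → beyond d x ≡ true
  beyond-nested {d} {y} td ty αd~y y≢αd yx = Conn-invariant P P-σ P-α (beyond-true yx) P-αy yx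
    where
      y∉d : ¬ y ∈ₑ d
      y∉d (inj₁ refl) = not-loop td (SameV-sym αd~y)
      y∉d (inj₂ y≡αd) = y≢αd y≡αd

      αd-not-beyond-y : beyond y (α d) ≡ false
      αd-not-beyond-y = beyond-own-vertex ty (SameV-sym αd~y)

      d-not-beyond-y : ∀ {w} → w ∈ₑ d → beyond y w ≡ false
      d-not-beyond-y (inj₂ refl) = αd-not-beyond-y
      d-not-beyond-y (inj₁ refl) = begin
        beyond y d         ≡⟨ cong (beyond y) (α-invol d) ⟨
        beyond y (α (α d)) ≡⟨ beyond-α ty (T-α td) (y∉d ∘ ∈ₑ-flip ∘ ∈ₑ-sym) ⟩
        beyond y (α d)     ≡⟨ αd-not-beyond-y ⟩
        false              ∎
        where open ≡-Reasoning

      P : Fin n → Set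
      P z = beyond y z ≡ true → beyond d z ≡ true

      P-σ : ∀ z → P z → P (σf M z)
      P-σ z Pz yσz = trans (beyond-σ td z) (Pz (trans (sym (beyond-σ ty z)) yσz))

      P-α : ∀ z → (T∖ y) z ≡ true → P z → P (α z)
      P-α z r Pz yαz with T∖-elim r | z ∈ₑ? d
      ... | _       | yes z∈d = ⊥-elim (true-false-clash yαz (d-not-beyond-y (∈ₑ-α z∈d)))
      ... | tz , z∉y | no z∉d = trans (beyond-α td tz z∉d) (Pz (trans (sym (beyond-α ty tz z∉y)) yαz))

      P-αy : P (α y)
      P-αy _ = trans (beyond-α td ty y∉d) (trans (sym (beyond-SameV td αd~y)) (beyond-α-self td))

  beyond-disjoint : ∀ {h h′ z} → T h ≡ true → T h′ ≡ true → SameV M h h′ → h ≢ h′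
                  → beyond h′ z ≡ true → beyond h z ≡ false
  beyond-disjoint {h} {h′} th th′ h~h′ h≢h′ h′z = beyond-flip-true th
    (beyond-nested (T-α th) th′ (subst (λ w → SameV M w h′) (sym (α-invol h)) h~h′)
                   (λ h′≡ααh → h≢h′ (sym (trans h′≡ααh (α-invol h)))) h′z)

  Separates : Fin n → Fin n → Fin n → Set
  Separates d x y = beyond d x ≢ beyond d y

  separates-by : ∀ {d x y} → beyond d x ≡ true → beyond d y ≡ false → Separates d x y
  separates-by x-far y-near eq = true-false-clash x-far (trans eq y-near)

  same-side-∈ₑ : ∀ {d h x y} → T d ≡ true → h ∈ₑ d → beyond d x ≡ beyond d y → beyond h x ≡ beyond h y
  same-side-∈ₑ td (inj₁ refl) eq = eq
  same-side-∈ₑ {d} {x = x} {y} td (inj₂ refl) eq =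
    trans (beyond-flip td x) (trans (cong not eq) (sym (beyond-flip td y)))

  separates-∈ₑ : ∀ {d h x y} → T d ≡ true → h ∈ₑ d → Separates d x y → Separates h x y
  separates-∈ₑ td (inj₁ refl) sep = sep
  separates-∈ₑ {d} {x = x} {y} td (inj₂ refl) sep eq =
    sep (not-injective (trans (sym (beyond-flip td x)) (trans eq (beyond-flip td y))))

  crossing : ∀ {d h} → T d ≡ true → T h ≡ true → beyond d h ≢ beyond d (α h) → h ∈ₑ d
  crossing {d} {h} td th sep with h ∈ₑ? d
  ... | yes h∈d = h∈d
  ... | no  h∉d = ⊥-elim (sep (sym (beyond-α td th h∉d)))

  orient : ∀ {g} → T g ≡ true → ∃ λ d → d ∈ₑ g × T d ≡ true × beyond d h₀ ≡ false
  orient {g} tg with true-or-false (beyond g h₀)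
  ... | inj₂ root-near = g , inj₁ refl , tg , root-near
  ... | inj₁ root-far  = α g , inj₂ refl , T-α tg , trans (beyond-flip tg h₀) (cong not root-far)

  side-preserving⇒ends-disconnected : ∀ {d S} → T d ≡ true → (∀ x → S x ≡ true → beyond d (α x) ≡ beyond d x)
                                    → ¬ Conn M S d (α d)
  side-preserving⇒ends-disconnected {d} td preserves p =
    true-false-clash (trans (Conn-preserves (beyond d) (beyond-σ td) preserves p) (beyond-α-self td)) (beyond-self td)

  beyond-separated : ∀ {d x y} → Separates d x y → beyond d x ≡ false → beyond d y ≡ true
  beyond-separated x|y x-near = trans (¬-not (≢-sym x|y)) (cong not x-near)

  same-side⇒Conn : ∀ {d a b} → T d ≡ true → beyond d a ≡ beyond d b → Conn M (T∖ d) a b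
  same-side⇒Conn {d} {a} td eq with true-or-false (beyond d a)
  ... | inj₁ a-far  = Conn-trans (Conn-sym (T∖-EdgeSet d) (beyond-true a-far)) (beyond-true (trans (sym eq) a-far))
  ... | inj₂ a-near = Conn-trans (Conn-sym (T∖-EdgeSet d) (beyond-false a-near)) (beyond-false (trans (sym eq) a-near))

  -- The tour of the motion function

  beyondSet : Fin n → Subset n
  beyondSet d = tabulate (beyond d)

  ∈-beyondSet : ∀ {d x} → beyond d x ≡ true → x ∈ beyondSet d
  ∈-beyondSet {d} {x} dx = lookup⇒[]= x (beyondSet d) (trans (lookup∘tabulate (beyond d) x) dx)

  ∈-beyondSet⁻ : ∀ {d x} → x ∈ beyondSet d → beyond d x ≡ true
  ∈-beyondSet⁻ {d} {x} x∈ = trans (sym (lookup∘tabulate (beyond d) x)) ([]=⇒lookup x∈)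

  beyondSet-shrinks : ∀ {d y} → T d ≡ true → T y ≡ true → SameV M (α d) y → y ≢ α d
                    → ∣ beyondSet y ∣ < ∣ beyondSet d ∣
  beyondSet-shrinks {d} {y} td ty αd~y y≢αd = p⊂q⇒∣p∣<∣q∣
    ( ∈-beyondSet ∘ beyond-nested td ty αd~y y≢αd ∘ ∈-beyondSet⁻
    , α d , ∈-beyondSet (beyond-α-self td)
    , λ αd∈ → true-false-clash (∈-beyondSet⁻ αd∈) (beyond-own-vertex ty (SameV-sym αd~y)) )

  motion-tree : ∀ {h} → T h ≡ true → motion M T h ≡ σf M (α h)
  motion-tree {h} th with T h
  motion-tree {h} refl | true = refl

  motion-cotree : ∀ {h} → T h ≡ false → motion M T h ≡ σf M h
  motion-cotree {h} th with T h
  motion-cotree {h} refl | false = refl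

  motion-α : ∀ {h} → T h ≡ true → motion M T (α h) ≡ σf M h
  motion-α {h} th = trans (motion-tree (T-α th)) (cong (σf M) (α-invol h))

  motion-injective : Injective _≡_ _≡_ (motion M T)
  motion-injective {a} {b} eq with true-or-false (T a) | true-or-false (T b)
  ... | inj₁ ta | inj₁ tb = α-injective (σ-injective (trans (sym (motion-tree ta)) (trans eq (motion-tree tb))))
  ... | inj₂ ta | inj₂ tb = σ-injective (trans (sym (motion-cotree ta)) (trans eq (motion-cotree tb)))
  ... | inj₁ ta | inj₂ tb = ⊥-elim (true-false-clash (T-α ta) (trans (cong T αa≡b) tb))
    where αa≡b = σ-injective (trans (sym (motion-tree ta)) (trans eq (motion-cotree tb)))
  ... | inj₂ ta | inj₁ tb = ⊥-elim (true-false-clash (T-α tb) (trans (cong T αb≡a) ta))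
    where αb≡a = σ-injective (trans (sym (motion-tree tb)) (trans (sym eq) (motion-cotree ta)))

  Beyond : Fin n → Fin n → Set
  Beyond d x = beyond d x ≡ true

  -- Go round the vertex of α d; each other tree half-edge y met there is handled by the
  -- (smaller) tour beyond y, which comes back to α y.
  tour-acc : ∀ {d} → Acc _<_ ∣ beyondSet d ∣ → T d ≡ true → Walk (motion M T) (Beyond d) d (α d)
  tour-acc {d} (acc smaller) td with r , _ , ret ← iter-returns σ-injective (α d) =
    subst (Walk (motion M T) _ d) ret (around r)
    where
      at-αd : ∀ {y} → SameV M (α d) y → beyond d y ≡ true
      at-αd αd~y = trans (sym (beyond-SameV td αd~y)) (beyond-α-self td)

      next : ∀ {y} → SameV M (α d) y → Walk (motion M T) (Beyond d) d y
           → Walk (motion M T) (Beyond d) d (σf M y)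
      next {y} αd~y w with T y in ty | y ≟ α d
      ... | false | _        = w ∷ʳ (motion-cotree ty , at-αd (SameV-trans αd~y SameV-σ))
      ... | true  | yes refl = [ motion-tree td , at-αd SameV-σ ]
      ... | true  | no y≢αd  =
        w ++ (Walk-mono (motion M T) (beyond-nested td ty αd~y y≢αd)
                        (tour-acc (smaller (beyondSet-shrinks td ty αd~y y≢αd)) ty)
              ∷ʳ (motion-α ty , at-αd (SameV-trans αd~y SameV-σ)))

      around : ∀ j → Walk (motion M T) (Beyond d) d (iter (σf M) (suc j) (α d))
      around zero    = [ motion-tree td , at-αd SameV-σ ]
      around (suc j) = next (suc j , refl) (around j)

  tour : ∀ {d} → T d ≡ true → Walk (motion M T) (Beyond d) d (α d)
  tour {d} = tour-acc (<-wellFounded ∣ beyondSet d ∣)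

  motion-covers : ∀ x₀ y → ∃ λ k → iter (motion M T) k x₀ ≡ y
  motion-covers x₀ y = Conn-invariant Reached (λ _ → Reached-σ) (λ _ → Reached-α) (T-connected x₀ y) (0 , refl)
    where
      Reached : Fin n → Set
      Reached z = ∃ λ k → iter (motion M T) k x₀ ≡ z

      Reached-α : ∀ {z} → T z ≡ true → Reached z → Reached (α z)
      Reached-α tz (k , refl) with q , _ , eq , _ ← walk-interval (motion M T) {p = k} (tour tz) = q , eq

      Reached-σ : ∀ {z} → Reached z → Reached (σf M z)
      Reached-σ {z} (k , eq) with true-or-false (T z)
      ... | inj₂ tz = suc k , trans (cong (motion M T) eq) (motion-cotree tz)
      ... | inj₁ tz with k′ , eq′ ← Reached-α tz (k , eq) = suc k′ , trans (cong (motion M T) eq′) (motion-α tz)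

  visit : ℕ → Fin n
  visit k = iter (motion M T) k h₀

  visit-index : ∀ y → ∃ λ k → k < n × visit k ≡ y
  visit-index = index motion-injective h₀ (motion-covers h₀)

  visit-unique : ∀ {a b} → a < n → b < n → visit a ≡ visit b → a ≡ b
  visit-unique = index-unique motion-injective h₀ (motion-covers h₀)

  record FarInterval (d : Fin n) : Set where
    field
      start end     : ℕ
      start<n       : start < n
      end<n         : end < n
      visit-start   : visit start ≡ d
      visit-end     : visit end ≡ α d
      inside⇒beyond : ∀ {k} → start < k → k ≤ end → beyond d (visit k) ≡ true
      beyond⇒inside : ∀ {k} → k < n → beyond d (visit k) ≡ true → start < k × k ≤ end

  farInterval : ∀ {d} → T d ≡ true → beyond d h₀ ≡ false → FarInterval d
  farInterval {d} td root-near
    with p , p<n , visit-p ← visit-index d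
    with q , p<q , visit-q , far ← walk-interval (motion M T) {x₀ = h₀} {p = p}
           (subst (λ z → Walk (motion M T) (Beyond d) z (α d)) (sym visit-p) (tour td))
    with a , q<a , visit-a , near ← walk-interval (motion M T) {x₀ = h₀} {p = q}
           (subst (λ z → Walk (motion M T) (Beyond (α d)) z (α (α d))) (sym visit-q) (tour (T-α td)))
    with q<n , bounds ← true-run-bounds motion-injective h₀ (motion-covers h₀) (beyond d) p<n p<q q<a
           (trans visit-a (trans (α-invol d) (sym visit-p)))
           far (λ q<k k≤a → beyond-flip-true td (near q<k k≤a)) root-near
    = record
      { start = p ; end = q ; start<n = p<n ; end<n = q<n ; visit-start = visit-p ; visit-end = visit-q
      ; inside⇒beyond = far ; beyond⇒inside = bounds }

  module _ {d : Fin n} (I : FarInterval d) where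
    open FarInterval I

    no-endpoint-before : ∀ {x i j r} → beyond d x ≡ false → visit i ≡ x → i < j → j < n
                       → beyond d (visit j) ≡ true → r < i → ¬ visit r ∈ₑ d
    no-endpoint-before {i = i} {r = r} x-near visit-i i<j j<n j-far r<i (inj₁ visit-r) =
      true-false-clash (trans (cong (beyond d) (sym visit-i)) (inside⇒beyond start<i i≤end)) x-near
      where
        r≡start = visit-unique (<-trans r<i (<-trans i<j j<n)) start<n (trans visit-r (sym visit-start))
        start<i = subst (_< i) r≡start r<i
        i≤end = <⇒≤ (<-≤-trans i<j (proj₂ (beyond⇒inside j<n j-far)))
    no-endpoint-before x-near visit-i i<j j<n j-far r<i (inj₂ visit-r) =
      <-irrefl r≡end (<-trans r<i (<-≤-trans i<j (proj₂ (beyond⇒inside j<n j-far))))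
      where r≡end = visit-unique (<-trans r<i (<-trans i<j j<n)) end<n (trans visit-r (sym visit-end))

  -- Simple tree paths and ancestry

  Simple : List (Fin n) → Set
  Simple = AllPairs (λ u v → ¬ SameV M u v)

  TPath-head : ∀ {P : Fin n → Set} {a c vs} → TPath M T a c vs → P a → Any P vs
  TPath-head (stop _)     Pa = here Pa
  TPath-head (step _ _ _) Pa = here Pa

  TPath-restart : ∀ {a a′ c vs} → SameV M a a′ → TPath M T a′ c vs → ∃ λ ws → TPath M T a c ws
  TPath-restart a~a′ (stop a′~c)      = _ , stop (SameV-trans a~a′ a′~c)
  TPath-restart a~a′ (step a′~h th p) = _ , step (SameV-trans a~a′ a′~h) th p

  Conn⇒TPath : ∀ {a b} → Conn M T a b → ∃ λ vs → TPath M T a b vs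
  Conn⇒TPath here        = _ , stop SameV-refl
  Conn⇒TPath (viaσ p)    = TPath-restart SameV-σ (proj₂ (Conn⇒TPath p))
  Conn⇒TPath (viaα th p) = _ , step SameV-refl th (proj₂ (Conn⇒TPath p))

  TPath-shortcut : ∀ {a b c ws} → TPath M T b c ws → Simple ws → Any (SameV M a) ws
                 → ∃ λ vs → TPath M T a c vs × Simple vs
  TPath-shortcut (stop b~c)       _                    (here a~b) = _ , stop (SameV-trans a~b b~c) , [] ∷ []
  TPath-shortcut (step b~h th p)  (b∉ws ∷ simple)      (here a~b) =
    _ , step (SameV-trans a~b b~h) th p , All.map (λ b≁w a~w → b≁w (SameV-trans (SameV-sym a~b) a~w)) b∉ws ∷ simple
  TPath-shortcut (step _ _ p)     (_ ∷ simple)         (there a∈ws) = TPath-shortcut p simple a∈ws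

  simplify : ∀ {a c vs} → TPath M T a c vs → ∃ λ ws → TPath M T a c ws × Simple ws
  simplify (stop a~c) = _ , stop a~c , [] ∷ []
  simplify {a} (step a~h th p) with ws , p′ , simple ← simplify p with Any.any? (SameV? a) ws
  ... | yes a∈ws = TPath-shortcut p′ simple a∈ws
  ... | no  a∉ws = _ , step a~h th p′ , ¬Any⇒All¬ ws a∉ws ∷ simple

  simple-path : ∀ a c → ∃ λ vs → TPath M T a c vs × Simple vs
  simple-path a c = simplify (proj₂ (Conn⇒TPath (T-connected a c)))

  stays-or-returns : ∀ {d a c vs} → T d ≡ true → TPath M T a c vs → beyond d a ≡ true
                   → beyond d c ≡ true ⊎ Any (λ y → SameV M y d) vs
  stays-or-returns td (stop a~c) a-far = inj₁ (trans (sym (beyond-SameV td a~c)) a-far)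
  stays-or-returns {d} td (step {h = h} a~h th p) a-far with h ∈ₑ? d
  ... | yes (inj₁ refl) = ⊥-elim (true-false-clash a-far (beyond-own-vertex td (SameV-sym a~h)))
  ... | yes (inj₂ refl) = inj₂ (there (TPath-head p (0 , α-invol d)))
  ... | no  h∉d with stays-or-returns td p (trans (beyond-α td th h∉d) (trans (sym (beyond-SameV td a~h)) a-far))
  ...   | inj₁ c-far   = inj₁ c-far
  ...   | inj₂ returns = inj₂ (there returns)

  -- Coming back would mean crossing d towards the vertex of d, which the path has already left.
  stays-beyond : ∀ {d a c vs} → T d ≡ true → TPath M T a c vs → Simple vs → beyond d a ≡ false
               → Any (λ y → beyond d y ≡ true) vs → beyond d c ≡ true
  stays-beyond td (stop _)     _ a-near (here a-far) = ⊥-elim (true-false-clash a-far a-near)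
  stays-beyond td (step _ _ _) _ a-near (here a-far) = ⊥-elim (true-false-clash a-far a-near)
  stays-beyond {d} td (step {h = h} a~h th p) (a∉vs ∷ simple) a-near (there far∈vs) with h ∈ₑ? d
  ... | yes (inj₁ refl) with stays-or-returns td p (beyond-α-self td)
  ...   | inj₁ c-far   = c-far
  ...   | inj₂ returns = ⊥-elim (All¬⇒¬Any a∉vs (Any.map (λ y~d → SameV-trans a~h (SameV-sym y~d)) returns))
  stays-beyond td (step a~h _ _) _ a-near _ | yes (inj₂ refl) =
    ⊥-elim (true-false-clash (trans (beyond-SameV td a~h) (beyond-α-self td)) a-near)
  stays-beyond {d} td (step {h = h} a~h th p) (_ ∷ simple) a-near (there far∈vs) | no h∉d =
    stays-beyond td p simple (trans (beyond-α td th h∉d) (trans (sym (beyond-SameV td a~h)) a-near)) far∈vs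

  toward : ∀ a y → SameV M a y ⊎ ∃ λ h → SameV M a h × T h ≡ true × beyond h y ≡ true
  toward a y = Conn-invariant P P-σ P-α (T-connected a y) (inj₁ SameV-refl)
    where
      P : Fin n → Set
      P z = SameV M a z ⊎ ∃ λ h → SameV M a h × T h ≡ true × beyond h z ≡ true

      P-σ : ∀ z → P z → P (σf M z)
      P-σ z (inj₁ a~z)                 = inj₁ (SameV-trans a~z SameV-σ)
      P-σ z (inj₂ (h , a~h , th , hz)) = inj₂ (h , a~h , th , trans (beyond-σ th z) hz)

      P-α : ∀ z → T z ≡ true → P z → P (α z)
      P-α z tz (inj₁ a~z) = inj₂ (z , a~z , tz , beyond-α-self tz)
      P-α z tz (inj₂ (h , a~h , th , hz)) with z ∈ₑ? h
      ... | yes (inj₁ refl) = ⊥-elim (true-false-clash hz (beyond-self th))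
      ... | yes (inj₂ refl) = inj₁ (subst (SameV M a) (sym (α-invol h)) a~h)
      ... | no  z∉h         = inj₂ (h , a~h , th , trans (beyond-α th tz z∉h) hz)

  off-path : ∀ {a c vs} → TPath M T a c vs → ∀ y
           → Any (SameV M y) vs ⊎ ∃ λ d → T d ≡ true × Separates d y a × Separates d y c
  off-path {a} (stop a~c) y with toward a y
  ... | inj₁ a~y = inj₁ (here (SameV-sym a~y))
  ... | inj₂ (h , a~h , th , y-far) =
    inj₂ (h , th , separates-by y-far (beyond-own-vertex th (SameV-sym a~h))
              , separates-by y-far (beyond-own-vertex th (SameV-trans (SameV-sym a~h) a~c)))
  off-path {a} {c} (step {h = h} a~h th p) y with off-path p y
  ... | inj₁ y∈vs = inj₁ (there y∈vs)
  ... | inj₂ (d , td , y|αh , y|c) with beyond d y Bool.≟ beyond d a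
  ...   | no  y|a = inj₂ (d , td , y|a , y|c)
  ...   | yes y≡a with toward a y
  ...     | inj₁ a~y = inj₁ (here (SameV-sym a~y))
  ...     | inj₂ (h′ , a~h′ , th′ , y-far) =
    inj₂ (h′ , th′ , separates-by y-far (beyond-own-vertex th′ (SameV-sym a~h′)) , separates-by y-far c-near)
    where
      -- y is on a's side of d but α h is not, so the step through h crosses d. The first
      -- tree edge h′ from a towards y is then not h, and c, lying beyond h, is not beyond h′.
      y~h : beyond d y ≡ beyond d h
      y~h = trans y≡a (beyond-SameV td a~h)

      h∈d : h ∈ₑ d
      h∈d = crossing td th (λ eq → y|αh (trans y~h eq))

      y-near-h : beyond h y ≡ false
      y-near-h = trans (same-side-∈ₑ td h∈d y~h) (beyond-self th)

      c-far-h : beyond h c ≡ true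
      c-far-h = trans (¬-not (≢-sym (separates-∈ₑ td h∈d y|c))) (cong not y-near-h)

      c-near : beyond h′ c ≡ false
      c-near = beyond-disjoint th′ th (SameV-trans (SameV-sym a~h′) a~h)
                 (λ { refl → true-false-clash y-far y-near-h }) c-far-h

  CutAncestor : Fin n → Fin n → Set
  CutAncestor u v = ∀ d → T d ≡ true → Separates d h₀ u → Separates d h₀ v

  Ancestor⇒CutAncestor : ∀ {u v} → Ancestor M T u v → CutAncestor u v
  Ancestor⇒CutAncestor (vs , path , simple , u∈vs) g tg g|u with d , d∈g , td , root-near ← orient tg =
    separates-∈ₑ td (∈ₑ-sym d∈g) (≢-sym (separates-by v-far root-near))
    where
      u-far = beyond-separated (separates-∈ₑ tg d∈g g|u) root-near
      v-far = stays-beyond td path simple root-near (Any.map (λ u~y → trans (sym (beyond-SameV td u~y)) u-far) u∈vs)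

  CutAncestor⇒Ancestor : ∀ {u v} → CutAncestor u v → Ancestor M T u v
  CutAncestor⇒Ancestor {u} {v} cut with vs , path , simple ← simple-path h₀ v with off-path path u
  ... | inj₁ u∈vs = vs , path , simple , u∈vs
  ... | inj₂ (d , td , u|root , u|v) = ⊥-elim (u|v (≢-≢⇒≡ u|root (cut d td (≢-sym u|root))))

  -- Fundamental cycles and activity

  module _ {e : Fin n} (te : T e ≡ false) where

    T-∉ₑe : ∀ {x} → T x ≡ true → ¬ x ∈ₑ e
    T-∉ₑe tx (inj₁ refl) = true-false-clash tx te
    T-∉ₑe tx (inj₂ refl) = true-false-clash (T-α tx) (trans (cong T (α-invol e)) te)

    exchange : Fin n → Fin n → Bool
    exchange g = addEdge M (T∖ g) e

    exchange-intro : ∀ {g z} → (T∖ g) z ≡ true → exchange g z ≡ true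
    exchange-intro {g} = addEdge-intro {S = T∖ g}

    exchange-new : ∀ {g z} → z ∈ₑ e → exchange g z ≡ true
    exchange-new {g} = addEdge-new {S = T∖ g}

    exchange-elim : ∀ {g z} → exchange g z ≡ true → (T∖ g) z ≡ true ⊎ z ∈ₑ e
    exchange-elim {g} = addEdge-elim {S = T∖ g}

    beyond-across-e : ∀ {g z} → beyond g e ≡ beyond g (α e) → z ∈ₑ e → beyond g (α z) ≡ beyond g z
    beyond-across-e same (inj₁ refl) = sym same
    beyond-across-e same (inj₂ refl) = trans (cong (beyond _) (α-invol e)) same

    fundamental⇒tree : ∀ {g} → InFundCycle M T e g → T g ≡ true
    fundamental⇒tree {g} (_ , _ , minimal) with true-or-false (T g)
    ... | inj₁ tg = tg
    ... | inj₂ tg = ⊥-elim (minimal e (exchange-new (inj₁ refl)) λ a b → Conn-mono T⊆ (T-connected a b))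
      where
        T⊆ : ∀ z → T z ≡ true → removeEdge M (exchange g) e z ≡ true
        T⊆ z tz = removeEdge-intro {S = exchange g} (exchange-intro (T∖-intro tz z∉g)) (T-∉ₑe tz)
          where
            z∉g : ¬ z ∈ₑ g
            z∉g (inj₁ refl) = true-false-clash tz tg
            z∉g (inj₂ refl) = true-false-clash tz (trans (sym (T-EdgeSet g)) tg)

    fundamental⇒separates : ∀ {g} → InFundCycle M T e g → Separates g e (α e)
    fundamental⇒separates {g} in-cycle@(_ , connected , _) same =
      side-preserving⇒ends-disconnected tg beyond-α-T′ (connected g (α g))
      where
        tg = fundamental⇒tree in-cycle

        beyond-α-T′ : ∀ z → exchange g z ≡ true → beyond g (α z) ≡ beyond g z
        beyond-α-T′ z r with exchange-elim r
        ... | inj₁ r′  = beyond-α tg (proj₁ (T∖-elim r′)) (proj₂ (T∖-elim r′))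
        ... | inj₂ z∈e = beyond-across-e same z∈e

    exchange-EdgeSet : ∀ g → EdgeSet M (exchange g)
    exchange-EdgeSet g = addEdge-EdgeSet e (T∖-EdgeSet g)

    -- hs is the end of e on g's side of d; the part of that side cut off from hs by g
    -- receives no new edge.
    exchange-minimal : ∀ {d g} → T d ≡ true → Separates d e (α e) → (T∖ d) g ≡ true
                     → ¬ Connected M (removeEdge M (exchange d) g)
    exchange-minimal {d} {g} td d|e r-g connected = proj₂ (Conn-invariant P P-σ P-α (connected w₀ hs) P-w₀) refl
      where
        tg = proj₁ (T∖-elim r-g)
        g∉d = proj₂ (T∖-elim r-g)

        hs-choice : ∃ λ hs → hs ∈ₑ e × beyond d hs ≡ beyond d g × beyond d (α hs) ≢ beyond d g
        hs-choice with beyond d e Bool.≟ beyond d g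
        ... | yes e~g = e , inj₁ refl , e~g , λ αe~g → d|e (trans e~g (sym αe~g))
        ... | no  e≁g = α e , inj₂ refl , ≢-≢⇒≡ (≢-sym d|e) e≁g
                      , λ ααe~g → e≁g (trans (cong (beyond d) (sym (α-invol e))) ααe~g)

        hs = proj₁ hs-choice
        hs∈e = proj₁ (proj₂ hs-choice)

        w₀-choice : ∃ λ w → w ∈ₑ g × beyond g w ≢ beyond g hs
        w₀-choice with true-or-false (beyond g hs)
        ... | inj₁ hs-far  = g , inj₁ refl , ≢-sym (separates-by hs-far (beyond-self tg))
        ... | inj₂ hs-near = α g , inj₂ refl , separates-by (beyond-α-self tg) hs-near

        w₀ = proj₁ w₀-choice

        P : Fin n → Set
        P z = beyond d z ≡ beyond d g × beyond g z ≢ beyond g hs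

        P-σ : ∀ z → P z → P (σf M z)
        P-σ z (z~g , z≁hs) = trans (beyond-σ td z) z~g , λ eq → z≁hs (trans (sym (beyond-σ tg z)) eq)

        P-α : ∀ z → removeEdge M (exchange d) g z ≡ true → P z → P (α z)
        P-α z r (z~g , z≁hs) with removeEdge-elim {S = exchange d} r
        ... | r′ , z∉g with exchange-elim r′
        ...   | inj₁ r-z = trans (beyond-α td tz z∉d) z~g , λ eq → z≁hs (trans (sym (beyond-α tg tz z∉g)) eq)
          where tz = proj₁ (T∖-elim r-z)
                z∉d = proj₂ (T∖-elim r-z)
        ...   | inj₂ z∈e with ∈ₑ-trans z∈e (∈ₑ-sym hs∈e)
        ...     | inj₁ refl = ⊥-elim (z≁hs refl)
        ...     | inj₂ refl = ⊥-elim (proj₂ (proj₂ (proj₂ hs-choice)) z~g)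

        P-w₀ : P w₀
        P-w₀ with w₀-choice
        ... | _ , inj₁ refl , w₀≁hs = refl , w₀≁hs
        ... | _ , inj₂ refl , w₀≁hs = beyond-α td tg g∉d , w₀≁hs

    separates⇒fundamental : ∀ {d} → T d ≡ true → Separates d e (α e) → InFundCycle M T e d
    separates⇒fundamental {d} td d|e = exchange-EdgeSet d , connected , minimal
      where
        to-e : ∀ a → Conn M (exchange d) a e
        to-e a with beyond d a Bool.≟ beyond d e
        ... | yes a~e = Conn-mono (λ _ → exchange-intro) (same-side⇒Conn td a~e)
        ... | no  a≁e = Conn-trans (Conn-mono (λ _ → exchange-intro) (same-side⇒Conn td (≢-≢⇒≡ a≁e d|e)))
                                   (Conn-α (exchange-EdgeSet d) (exchange-new (inj₁ refl)))

        connected : Connected M (exchange d)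
        connected a b = Conn-trans (to-e a) (Conn-sym (exchange-EdgeSet d) (to-e b))

        minimal : ∀ g → exchange d g ≡ true → ¬ Connected M (removeEdge M (exchange d) g)
        minimal g r with exchange-elim r
        ... | inj₁ r-g = exchange-minimal td d|e r-g
        ... | inj₂ g∈e = λ connected′ → side-preserving⇒ends-disconnected td (beyond-α-T′ g∈e) (connected′ d (α d))
          where
            beyond-α-T′ : g ∈ₑ e → ∀ z → removeEdge M (exchange d) g z ≡ true → beyond d (α z) ≡ beyond d z
            beyond-α-T′ g∈e z r′ with removeEdge-elim {S = exchange d} r′
            ... | r″ , z∉g with exchange-elim r″
            ...   | inj₁ r-z = beyond-α td (proj₁ (T∖-elim r-z)) (proj₂ (T∖-elim r-z))
            ...   | inj₂ z∈e = ⊥-elim (z∉g (∈ₑ-trans z∈e (∈ₑ-sym g∈e)))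

    Active⇒CutAncestor : OrdLt M T e (α e) → Active M T e → CutAncestor e (α e)
    Active⇒CutAncestor (i₁ , i₂ , i₁<i₂ , i₂<n , visit-i₁ , visit-i₂) (_ , minimal) g tg g|e root~αe
      with d , d∈g , td , root-near ← orient tg =
      minimal d (separates⇒fundamental td (separates-by e-far αe-near))
        (d , inj₁ refl , (start , i₁ , start<i₁ , i₁<n , visit-start , visit-i₁)
                       , (start , i₂ , <-trans start<i₁ i₁<i₂ , i₂<n , visit-start , visit-i₂))
      where
        open FarInterval (farInterval td root-near)
        i₁<n = <-trans i₁<i₂ i₂<n
        e-far = beyond-separated (separates-∈ₑ tg d∈g g|e) root-near
        αe-near = trans (sym (same-side-∈ₑ tg d∈g root~αe)) root-near
        start<i₁ = proj₁ (beyond⇒inside i₁<n (trans (cong (beyond d) visit-i₁) e-far))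

    CutAncestor⇒Active : OrdLt M T e (α e) → CutAncestor e (α e) → Active M T e
    CutAncestor⇒Active (i₁ , i₂ , i₁<i₂ , i₂<n , visit-i₁ , visit-i₂) cut = te , not-below
      where
        not-below : ∀ g → InFundCycle M T e g → ¬ EdgeLt M T g e
        not-below g in-cycle (a , a∈g , (r , j , r<j , j<n , visit-r , visit-j) , _)
          with d , d∈g , td , root-near ← orient (fundamental⇒tree in-cycle) =
          no-endpoint-before (farInterval td root-near) e-near visit-i₁ i₁<i₂ i₂<n
            (trans (cong (beyond d) visit-i₂) αe-far) r<i₁
            (subst (_∈ₑ d) (sym visit-r) (∈ₑ-trans a∈g (∈ₑ-sym d∈g)))
          where
            d|e = separates-∈ₑ (fundamental⇒tree in-cycle) d∈g (fundamental⇒separates in-cycle)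
            e-near : beyond d e ≡ false
            e-near with true-or-false (beyond d e)
            ... | inj₂ e-near = e-near
            ... | inj₁ e-far  =
              ⊥-elim (d|e (trans e-far (sym (beyond-separated (cut d td (≢-sym (separates-by e-far root-near))) root-near))))
            αe-far = beyond-separated d|e e-near
            r<i₁ = subst (r <_) (visit-unique j<n (<-trans i₁<i₂ i₂<n) (trans visit-j (sym visit-i₁))) r<j

lemma7 : ∀ {n} (M : RootedMap n) (T : Fin n → Bool) → SpanningTree M T
         → (h₁ : Fin n) → T h₁ ≡ false → OrdLt M T h₁ (RootedMap.α M h₁)
         → (Active M T h₁ → Ancestor M T h₁ (RootedMap.α M h₁))
           × (Ancestor M T h₁ (RootedMap.α M h₁) → Active M T h₁)
lemma7 M T tree h₁ th₁ h₁<h₂ =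
    CutAncestor⇒Ancestor ∘ Active⇒CutAncestor th₁ h₁<h₂
  , CutAncestor⇒Active th₁ h₁<h₂ ∘ Ancestor⇒CutAncestor
  where open SpanningTreeFacts M tree
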